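{- Let $k$ be a positive integer and $G$ a graph. Then $\gamma_{P,k}(G-e)>\gamma_{P,k}(G)$ for every edge $e$ of $G$ if and only if $G$ is a disjoint union of $k$-generalized spiders.
   Context: All graphs are finite and simple. $G-e$ is obtained from $G$ by deleting the edge $e$. A $k$-generalized spider is a tree with at most one vertex of degree at least $k+2$. $N_G[v]$ is the closed neighbourhood of $v$ and $N_G[S]=\bigcup_{v\in S}N_G[v]$. For $S\subseteq V(G)$, define $\mathcal{P}^{0}_{G,k}(S)=N_G[S]$ and $\mathcal{P}^{t+1}_{G,k}(S)=\bigcup\{N_G[u] : u\in \mathcal{P}^{t}_{G,k}(S),\ |N_G[u]\setminus \mathcal{P}^{t}_{G,k}(S)|\le k\}$; these sets increase and stabilize to $\mathcal{P}^{\infty}_{G,k}(S)$. $S$ is a $k$-power dominating set if $\mathcal{P}^{\infty}_{G,k}(S)=V(G)$; $\gamma_{P,k}(G)$ is the minimum size of such a set. -}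

module Defs where

open import Data.Bool using (Bool; true; false; _∧_; _∨_; not)
open import Data.Nat using (ℕ; zero; suc; _≤_; _≤ᵇ_; _+_)
open import Data.Fin using (Fin; zero; suc; _≟_)
open import Data.Fin.Subset using (Subset; _∈_; ∣_∣; _∩_; ∁)
open import Data.Vec using (tabulate; lookup)
open import Data.List using (List; []; _∷_; _++_; [_]; length)
open import Data.List.Relation.Unary.Unique.Propositional using (Unique)
open import Data.Product using (Σ; ∃; _×_)
open import Data.Unit using (⊤)
open import Relation.Nullary.Decidable using (⌊_⌋)
open import Relation.Binary.PropositionalEquality using (_≡_)

record Graph (n : ℕ) : Set where
  field
    adj : Fin n → Fin n → Bool
open Graph public

IsSimple : ∀ {n} → Graph n → Set
IsSimple G = (∀ u v → adj G u v ≡ adj G v u) × (∀ u → adj G u u ≡ false)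

deleteEdge : ∀ {n} → Graph n → Fin n → Fin n → Graph n
adj (deleteEdge G x y) u v =
  adj G u v ∧ not ((⌊ u ≟ x ⌋ ∧ ⌊ v ≟ y ⌋) ∨ (⌊ u ≟ y ⌋ ∧ ⌊ v ≟ x ⌋))

anyFin : ∀ {n} → (Fin n → Bool) → Bool
anyFin {zero}  f = false
anyFin {suc n} f = f zero ∨ anyFin (λ i → f (suc i))

openNbhd : ∀ {n} → Graph n → Fin n → Subset n
openNbhd G v = tabulate (adj G v)

closedNbhd : ∀ {n} → Graph n → Fin n → Subset n
closedNbhd G v = tabulate (λ u → ⌊ u ≟ v ⌋ ∨ adj G v u)

degree : ∀ {n} → Graph n → Fin n → ℕ
degree G v = ∣ openNbhd G v ∣

closedNbhdSet : ∀ {n} → Graph n → Subset n → Subset n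
closedNbhdSet G S = tabulate (λ w → anyFin (λ v → lookup S v ∧ lookup (closedNbhd G v) w))

propStep : ∀ {n} → Graph n → ℕ → Subset n → Subset n
propStep G k P = tabulate (λ w → anyFin (λ u →
  lookup P u ∧ (∣ closedNbhd G u ∩ ∁ P ∣ ≤ᵇ k) ∧ lookup (closedNbhd G u) w))

powerSet : ∀ {n} → Graph n → ℕ → Subset n → ℕ → Subset n
powerSet G k S zero    = closedNbhdSet G S
powerSet G k S (suc t) = propStep G k (powerSet G k S t)

IsPowerDominating : ∀ {n} → Graph n → ℕ → Subset n → Set
IsPowerDominating G k S = ∀ v → ∃ λ t → v ∈ powerSet G k S t

PowerDomNumber : ∀ {n} → Graph n → ℕ → ℕ → Set
PowerDomNumber {n} G k m =
  (Σ (Subset n) λ S → ∣ S ∣ ≡ m × IsPowerDominating G k S)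
  × (∀ S → IsPowerDominating G k S → m ≤ ∣ S ∣)

Linked : ∀ {n} → Graph n → List (Fin n) → Set
Linked G []            = ⊤
Linked G (x ∷ [])      = ⊤
Linked G (x ∷ y ∷ xs)  = adj G x y ≡ true × Linked G (y ∷ xs)

HasCycle : ∀ {n} → Graph n → Set
HasCycle {n} G = Σ (Fin n) λ v → Σ (List (Fin n)) λ vs →
  2 ≤ length vs × Unique (v ∷ vs) × Linked G (v ∷ vs ++ [ v ])

IsForest : ∀ {n} → Graph n → Set
IsForest G = HasCycle G → Data.Empty.⊥
  where import Data.Empty

data Reach {n} (G : Graph n) : Fin n → Fin n → Set where
  here : ∀ {u} → Reach G u u
  step : ∀ {u w v} → adj G u w ≡ true → Reach G w v → Reach G u v

-- G is a disjoint union of k-generalized spiders: every component is a tree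
-- (G is acyclic, components are connected by definition) with at most one
-- vertex of degree ≥ k+2.
IsUnionOfSpiders : ∀ {n} → ℕ → Graph n → Set
IsUnionOfSpiders k G = IsForest G ×
  (∀ u v → Reach G u v → k + 2 ≤ degree G u → k + 2 ≤ degree G v → u ≡ v)

-- Fix a minimum k-power dominating set S and give every vertex outside S a parent: a vertex
-- that observed it first. Ranks (first observation times, with S at time 0) strictly decrease
-- from child to parent. If every edge is critical, every edge is a parent edge, since any other
-- edge could be deleted without losing S. Walking along a path, edges then keep pointing the
-- same way, which excludes cycles and forbids a path from leaving one vertex of S and ending at
-- another; and a vertex of degree ≥ k + 2 lies in S, for otherwise its ≥ k + 1 children would
-- all still be unobserved when it forces the first of them.
-- Conversely, in a union of spiders deleting an edge xy separates x from y, so a power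
-- dominating set of G - xy has an observer on each side; both can be traded for the centre of
-- the spider, which on its own observes its whole component in G.

module Submission where

open import Defs
open import Data.Nat using (ℕ; _≤_; _<_)
open import Data.Fin using (Fin)
open import Data.Bool using (true)
open import Data.Product using (_×_)
open import Relation.Binary.PropositionalEquality using (_≡_)

open import Data.Bool using (Bool; false; _∧_; _∨_; not)
open import Data.Bool.Properties using (T-≡; ∧-comm; ∨-comm; ∧-zeroʳ)
open import Data.Empty using (⊥-elim)
open import Data.Fin using (zero; suc; _≟_)
open import Data.Fin.Properties using (all?) renaming (any? to anyFin?)
open import Data.Fin.Subset
  using (Subset; _∈_; _∉_; _⊆_; _⊄_; ∣_∣; _∩_; _∪_; ∁; ⁅_⁆; _-_; Empty; inside; outside)
  renaming (⊤ to full)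
open import Data.Fin.Subset.Properties
  using ( _∈?_; _⊂?_; anySubset?; ∣p∣≤n; ∣⊤∣≡n; ∣⊥∣≡0; ∣⁅x⁆∣≡1; ∈⊤; x∈⁅x⁆; x∈⁅y⁆⇒x≡y
        ; p⊆q⇒∣p∣≤∣q∣; p⊂q⇒∣p∣<∣q∣; x∈p∩q⁺; x∈p∩q⁻; x∈∁p⇒x∉p; x∉p⇒x∈∁p
        ; x∈p∪q⁺; nonempty?; Empty-unique; x≢y⇒x∉⁅y⁆; x∉⁅y⁆⇒x≢y; x∈p⇒∣p-x∣<∣p∣; x∈p∧x≢y⇒x∈p-y)
open import Data.List using (List; []; _∷_; _++_; [_]; length)
open import Data.List.Membership.Propositional using () renaming (_∈_ to _∈L_)
open import Data.List.Relation.Unary.All as All using ([]; _∷_)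
open import Data.List.Relation.Unary.All.Properties using (¬Any⇒All¬)
open import Data.List.Relation.Unary.AllPairs using ([]; _∷_)
open import Data.List.Relation.Unary.Any using (here; there; any?)
open import Data.List.Relation.Unary.Unique.Propositional using (Unique)
import Data.List.Relation.Unary.Unique.Propositional.Properties as Unique
open import Data.Nat using (zero; suc; _+_; _∸_; z≤n; s≤s; _≤?_)
open import Data.Nat.Properties as ℕ using (≤-refl; ≤-trans; ≤-reflexive)
open import Data.Product using (Σ; ∃; _,_; proj₁; proj₂)
open import Data.Sum using (_⊎_; inj₁; inj₂)
open import Data.Unit using (⊤; tt)
open import Data.Vec as Vec using (tabulate)
open import Data.Vec.Properties using (lookup∘tabulate; []=⇒lookup; lookup⇒[]=)
open import Function.Base using (_∘_)
open import Function.Bundles using (Equivalence)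
open import Relation.Nullary using (¬_; Dec; yes; no; ¬?)
open import Relation.Nullary.Decidable using (⌊_⌋; map′; _×-dec_)
open import Relation.Binary.PropositionalEquality using (refl; sym; trans; cong; subst; _≢_)

∨-true⁻ : ∀ {a b} → a ∨ b ≡ true → a ≡ true ⊎ b ≡ true
∨-true⁻ {true}  _ = inj₁ refl
∨-true⁻ {false} p = inj₂ p

∨-trueˡ : ∀ {a} b → a ≡ true → a ∨ b ≡ true
∨-trueˡ b refl = refl

∨-trueʳ : ∀ a {b} → b ≡ true → a ∨ b ≡ true
∨-trueʳ true  _ = refl
∨-trueʳ false p = p

∧-true⁻ : ∀ {a b} → a ∧ b ≡ true → a ≡ true × b ≡ true
∧-true⁻ {true} {true} _ = refl , refl

∧-true⁺ : ∀ {a b} → a ≡ true → b ≡ true → a ∧ b ≡ true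
∧-true⁺ refl refl = refl

≟-true⁻ : ∀ {n} {x y : Fin n} → ⌊ x ≟ y ⌋ ≡ true → x ≡ y
≟-true⁻ {x = x} {y} p with x ≟ y
... | yes x≡y = x≡y
... | no  _   with () ← p

≟-refl : ∀ {n} (x : Fin n) → ⌊ x ≟ x ⌋ ≡ true
≟-refl x with x ≟ x
... | yes _  = refl
... | no x≢x = ⊥-elim (x≢x refl)

≟∧≟-false : ∀ {n} {a b x y : Fin n} → ¬ (a ≡ x × b ≡ y) → ⌊ a ≟ x ⌋ ∧ ⌊ b ≟ y ⌋ ≡ false
≟∧≟-false {a = a} {b} {x} {y} ne with a ≟ x | b ≟ y
... | yes a≡x | yes b≡y = ⊥-elim (ne (a≡x , b≡y))
... | yes _   | no  _   = refl
... | no  _   | _       = refl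

anyFin-true⁻ : ∀ {n} (f : Fin n → Bool) → anyFin f ≡ true → ∃ λ i → f i ≡ true
anyFin-true⁻ {suc n} f p with ∨-true⁻ {f zero} p
... | inj₁ f0 = zero , f0
... | inj₂ fs with anyFin-true⁻ (λ i → f (suc i)) fs
...   | i , fi = suc i , fi

anyFin-true⁺ : ∀ {n} (f : Fin n → Bool) i → f i ≡ true → anyFin f ≡ true
anyFin-true⁺ f zero    fi = ∨-trueˡ _ fi
anyFin-true⁺ f (suc i) fi = ∨-trueʳ (f zero) (anyFin-true⁺ (λ j → f (suc j)) i fi)

∈-tabulate⁻ : ∀ {n} {f : Fin n → Bool} {x} → x ∈ tabulate f → f x ≡ true
∈-tabulate⁻ {f = f} {x} x∈ = trans (sym (lookup∘tabulate f x)) ([]=⇒lookup x∈)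

∈-tabulate⁺ : ∀ {n} {f : Fin n → Bool} {x} → f x ≡ true → x ∈ tabulate f
∈-tabulate⁺ {f = f} {x} fx = lookup⇒[]= x (tabulate f) (trans (lookup∘tabulate f x) fx)

∣p∪q∣≤∣p∣+∣q∣ : ∀ {n} (p q : Subset n) → ∣ p ∪ q ∣ ≤ ∣ p ∣ + ∣ q ∣
∣p∪q∣≤∣p∣+∣q∣ Vec.[] Vec.[] = z≤n
∣p∪q∣≤∣p∣+∣q∣ (inside Vec.∷ p) (inside Vec.∷ q) =
  s≤s (≤-trans (∣p∪q∣≤∣p∣+∣q∣ p q) (ℕ.+-monoʳ-≤ ∣ p ∣ (ℕ.n≤1+n ∣ q ∣)))
∣p∪q∣≤∣p∣+∣q∣ (inside Vec.∷ p) (outside Vec.∷ q) = s≤s (∣p∪q∣≤∣p∣+∣q∣ p q)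
∣p∪q∣≤∣p∣+∣q∣ (outside Vec.∷ p) (inside Vec.∷ q) =
  ≤-trans (s≤s (∣p∪q∣≤∣p∣+∣q∣ p q)) (≤-reflexive (sym (ℕ.+-suc ∣ p ∣ ∣ q ∣)))
∣p∪q∣≤∣p∣+∣q∣ (outside Vec.∷ p) (outside Vec.∷ q) = ∣p∪q∣≤∣p∣+∣q∣ p q

∣p∪⁅x⁆∣≤1+∣p∣ : ∀ {n} (p : Subset n) x → ∣ p ∪ ⁅ x ⁆ ∣ ≤ suc ∣ p ∣
∣p∪⁅x⁆∣≤1+∣p∣ p x = ≤-trans (∣p∪q∣≤∣p∣+∣q∣ p ⁅ x ⁆)
  (≤-reflexive (trans (cong (∣ p ∣ +_) (∣⁅x⁆∣≡1 x)) (ℕ.+-comm ∣ p ∣ 1)))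

∣p∣≤1+∣p∩∁⁅x⁆∣ : ∀ {n} (p : Subset n) x → ∣ p ∣ ≤ suc ∣ p ∩ ∁ ⁅ x ⁆ ∣
∣p∣≤1+∣p∩∁⁅x⁆∣ p x = ≤-trans (p⊆q⇒∣p∣≤∣q∣ split) (∣p∪⁅x⁆∣≤1+∣p∣ (p ∩ ∁ ⁅ x ⁆) x)
  where
  split : p ⊆ (p ∩ ∁ ⁅ x ⁆) ∪ ⁅ x ⁆
  split {y} y∈p with y ≟ x
  ... | yes refl = x∈p∪q⁺ (inj₂ (x∈⁅x⁆ y))
  ... | no  y≢x  = x∈p∪q⁺ (inj₁ (x∈p∩q⁺ (y∈p , x∉p⇒x∈∁p (x≢y⇒x∉⁅y⁆ y≢x))))

∣Empty∣≡0 : ∀ {n} {p : Subset n} → Empty p → ∣ p ∣ ≡ 0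
∣Empty∣≡0 {n} empty = trans (cong ∣_∣ (Empty-unique empty)) (∣⊥∣≡0 n)

⊆∧⊄⇒⊇ : ∀ {n} {p q : Subset n} → p ⊆ q → p ⊄ q → q ⊆ p
⊆∧⊄⇒⊇ {p = p} p⊆q p⊄q {x} x∈q with x ∈? p
... | yes x∈p = x∈p
... | no  x∉p = ⊥-elim (p⊄q (p⊆q , x , x∈q , x∉p))

least : ∀ {P : ℕ → Set} → (∀ i → Dec (P i)) → ∀ {t} → P t →
        ∃ λ m → P m × (∀ {i} → P i → m ≤ i)
least {P} P? {t} pt = search 0 t (λ _ → z≤n) pt
  where
  search : ∀ b d → (∀ {i} → P i → b ≤ i) → P (b + d) → ∃ λ m → P m × (∀ {i} → P i → m ≤ i)
  search b zero    below pb = b , subst P (ℕ.+-identityʳ b) pb , below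
  search b (suc d) below pbd with P? b
  ... | yes pb = b , pb , below
  ... | no ¬pb = search (suc b) d below′ (subst P (ℕ.+-suc b d) pbd)
    where
    below′ : ∀ {i} → P i → suc b ≤ i
    below′ {i} pi with ℕ.m≤n⇒m<n∨m≡n (below pi)
    ... | inj₁ b<i  = b<i
    ... | inj₂ refl = ⊥-elim (¬pb pi)

Symmetric : ∀ {n} → Graph n → Set
Symmetric G = ∀ u v → adj G u v ≡ adj G v u

InClosedNbhd : ∀ {n} → Graph n → Fin n → Fin n → Set
InClosedNbhd G v u = u ≡ v ⊎ adj G v u ≡ true

module _ {n} (G : Graph n) where

  ∈closedNbhd⁻ : ∀ {v u} → u ∈ closedNbhd G v → InClosedNbhd G v u
  ∈closedNbhd⁻ u∈ with ∨-true⁻ (∈-tabulate⁻ u∈)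
  ... | inj₁ u≡v = inj₁ (≟-true⁻ u≡v)
  ... | inj₂ vu  = inj₂ vu

  ∈closedNbhd⁺ : ∀ {v u} → InClosedNbhd G v u → u ∈ closedNbhd G v
  ∈closedNbhd⁺ {v} (inj₁ refl) = ∈-tabulate⁺ (∨-trueˡ _ (≟-refl v))
  ∈closedNbhd⁺ {v} {u} (inj₂ vu) = ∈-tabulate⁺ (∨-trueʳ ⌊ u ≟ v ⌋ vu)

  unobserved : Fin n → Subset n → ℕ
  unobserved u P = ∣ closedNbhd G u ∩ ∁ P ∣

  ∈unobserved⁻ : ∀ {u P z} → z ∈ closedNbhd G u ∩ ∁ P → InClosedNbhd G u z × z ∉ P
  ∈unobserved⁻ {u} {P} z∈ with x∈p∩q⁻ (closedNbhd G u) (∁ P) z∈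
  ... | z∈N , z∈∁P = ∈closedNbhd⁻ z∈N , x∈∁p⇒x∉p z∈∁P

  ∈unobserved⁺ : ∀ {u P z} → InClosedNbhd G u z → z ∉ P → z ∈ closedNbhd G u ∩ ∁ P
  ∈unobserved⁺ z∈N z∉P = x∈p∩q⁺ (∈closedNbhd⁺ z∈N , x∉p⇒x∈∁p z∉P)

  unobserved≡0 : ∀ {u P} → (∀ {z} → InClosedNbhd G u z → z ∈ P) → unobserved u P ≡ 0
  unobserved≡0 {u} {P} N[u]⊆P = ∣Empty∣≡0 λ (z , z∈) →
    let (z∈N , z∉P) = ∈unobserved⁻ z∈ in z∉P (N[u]⊆P z∈N)

  unobserved<degree : Symmetric G → ∀ {w p P} → w ∈ P → p ∈ P →
                      adj G p w ≡ true → unobserved w P < degree G w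
  unobserved<degree sym-adj {w} {p} {P} w∈P p∈P pw =
    p⊂q⇒∣p∣<∣q∣ (⊆open , p , ∈-tabulate⁺ (trans (sym-adj w p) pw) , λ p∈ → proj₂ (∈unobserved⁻ p∈) p∈P)
    where
    ⊆open : closedNbhd G w ∩ ∁ P ⊆ openNbhd G w
    ⊆open z∈ with ∈unobserved⁻ z∈
    ... | inj₁ refl , z∉P = ⊥-elim (z∉P w∈P)
    ... | inj₂ wz   , _   = ∈-tabulate⁺ wz

unobserved-mono : ∀ {n} (G G′ : Graph n) {u u′ P P′} →
  (∀ {z} → InClosedNbhd G′ u′ z → z ∉ P′ → InClosedNbhd G u z × z ∉ P) →
  unobserved G′ u′ P′ ≤ unobserved G u P
unobserved-mono G G′ h = p⊆q⇒∣p∣≤∣q∣ λ z∈ →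
  let (z∈N , z∉P′) = ∈unobserved⁻ G′ z∈ ; (z∈N′ , z∉P) = h z∈N z∉P′ in ∈unobserved⁺ G z∈N′ z∉P

module _ {n} (G : Graph n) (k : ℕ) where

  ∈closedNbhdSet⁻ : ∀ {S w} → w ∈ closedNbhdSet G S → ∃ λ s → s ∈ S × InClosedNbhd G s w
  ∈closedNbhdSet⁻ w∈ with anyFin-true⁻ _ (∈-tabulate⁻ w∈)
  ... | s , p with ∧-true⁻ p
  ...   | s∈S , w∈N = s , lookup⇒[]= s _ s∈S , ∈closedNbhd⁻ G (lookup⇒[]= _ _ w∈N)

  ∈closedNbhdSet⁺ : ∀ {S w s} → s ∈ S → InClosedNbhd G s w → w ∈ closedNbhdSet G S
  ∈closedNbhdSet⁺ {s = s} s∈S w∈N =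
    ∈-tabulate⁺ (anyFin-true⁺ _ s (∧-true⁺ ([]=⇒lookup s∈S) ([]=⇒lookup (∈closedNbhd⁺ G w∈N))))

  ∈propStep⁻ : ∀ {P w} → w ∈ propStep G k P →
               ∃ λ u → u ∈ P × unobserved G u P ≤ k × InClosedNbhd G u w
  ∈propStep⁻ w∈ with anyFin-true⁻ _ (∈-tabulate⁻ w∈)
  ... | u , p with ∧-true⁻ p
  ...   | u∈P , q with ∧-true⁻ q
  ...     | few , w∈N = u , lookup⇒[]= u _ u∈P , ℕ.≤ᵇ⇒≤ _ k (Equivalence.from T-≡ few)
                          , ∈closedNbhd⁻ G (lookup⇒[]= _ _ w∈N)

  ∈propStep⁺ : ∀ {P w u} → u ∈ P → unobserved G u P ≤ k → InClosedNbhd G u w → w ∈ propStep G k P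
  ∈propStep⁺ {u = u} u∈P few w∈N = ∈-tabulate⁺ (anyFin-true⁺ _ u (∧-true⁺ ([]=⇒lookup u∈P)
    (∧-true⁺ (Equivalence.to T-≡ (ℕ.≤⇒≤ᵇ few)) ([]=⇒lookup (∈closedNbhd⁺ G w∈N)))))

  propStep-mono : ∀ {P Q} → P ⊆ Q → propStep G k P ⊆ propStep G k Q
  propStep-mono P⊆Q w∈ with ∈propStep⁻ w∈
  ... | u , u∈P , few , w∈N =
    ∈propStep⁺ (P⊆Q u∈P) (≤-trans (unobserved-mono G G λ z∈N z∉Q → z∈N , z∉Q ∘ P⊆Q) few) w∈N

  closedNbhdSet⊆propStep : ∀ S → closedNbhdSet G S ⊆ propStep G k (closedNbhdSet G S)
  closedNbhdSet⊆propStep S w∈ with ∈closedNbhdSet⁻ {S} w∈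
  ... | s , s∈S , w∈N = ∈propStep⁺ (∈closedNbhdSet⁺ {S} s∈S (inj₁ refl))
    (≤-trans (≤-reflexive (unobserved≡0 G (∈closedNbhdSet⁺ {S} s∈S))) z≤n) w∈N

module IncreasingChain {n} (c : ℕ → Subset n) (⊆-suc : ∀ t → c t ⊆ c (suc t))
  (stays-stalled : ∀ t → c (suc t) ⊆ c t → c (suc (suc t)) ⊆ c (suc t)) where

  ⊆-mono : ∀ {t t′} → t ≤ t′ → c t ⊆ c t′
  ⊆-mono {t} t≤t′ with ℕ.m≤n⇒∃[o]m+o≡n t≤t′
  ... | o , refl = go o
    where
    go : ∀ o → c t ⊆ c (t + o)
    go zero    = subst (λ i → c t ⊆ c i) (sym (ℕ.+-identityʳ t)) (λ x∈ → x∈)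
    go (suc o) = subst (λ i → c t ⊆ c i) (sym (ℕ.+-suc t o)) (λ x∈ → ⊆-suc (t + o) (go o x∈))

  stalled-from : ∀ {j} → c (suc j) ⊆ c j → ∀ i → c (suc (i + j)) ⊆ c (i + j)
  stalled-from st zero    = st
  stalled-from st (suc i) = stays-stalled (i + _) (stalled-from st i)

  stalled-forever : ∀ {j} → c (suc j) ⊆ c j → ∀ i → c (i + j) ⊆ c j
  stalled-forever st zero    x∈ = x∈
  stalled-forever st (suc i) x∈ = stalled-forever st i (stalled-from st i x∈)

  grows-or-stalls : ∀ t → t ≤ ∣ c t ∣ ⊎ ∃ λ j → j < t × c (suc j) ⊆ c j
  grows-or-stalls zero = inj₁ z≤n
  grows-or-stalls (suc t) with grows-or-stalls t
  ... | inj₂ (j , j<t , st) = inj₂ (j , ℕ.m≤n⇒m≤1+n j<t , st)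
  ... | inj₁ t≤∣ct∣ with c t ⊂? c (suc t)
  ...   | yes ct⊂ = inj₁ (≤-trans (s≤s t≤∣ct∣) (p⊂q⇒∣p∣<∣q∣ ct⊂))
  ...   | no  ct⊄ = inj₂ (t , ≤-refl , ⊆∧⊄⇒⊇ (⊆-suc t) ct⊄)

  ⊆-at-n : ∀ t → c t ⊆ c n
  ⊆-at-n t with grows-or-stalls (suc n) | t ≤? n
  ... | inj₁ n<∣c∣ | _ = ⊥-elim (ℕ.<-irrefl refl (≤-trans n<∣c∣ (∣p∣≤n (c (suc n)))))
  ... | inj₂ _ | yes t≤n = ⊆-mono t≤n
  ... | inj₂ (j , j<1+n , st) | no t≰n =
    ⊆-mono j≤n ∘ stalled-forever st (t ∸ j) ∘ subst (λ i → c t ⊆ c i) (sym (ℕ.m∸n+n≡m j≤t)) (λ x∈ → x∈)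
    where
    j≤n : j ≤ n
    j≤n = ℕ.≤-pred j<1+n
    j≤t : j ≤ t
    j≤t = ≤-trans j≤n (ℕ.<⇒≤ (ℕ.≰⇒> t≰n))

powerSet-⊆-suc : ∀ {n} (G : Graph n) k S t → powerSet G k S t ⊆ powerSet G k S (suc t)
powerSet-⊆-suc G k S zero    = closedNbhdSet⊆propStep G k S
powerSet-⊆-suc G k S (suc t) = propStep-mono G k (powerSet-⊆-suc G k S t)

module PowerSet {n} (G : Graph n) (k : ℕ) (S : Subset n) =
  IncreasingChain (powerSet G k S) (powerSet-⊆-suc G k S) (λ _ → propStep-mono G k)

isPowerDominating? : ∀ {n} (G : Graph n) k S → Dec (IsPowerDominating G k S)
isPowerDominating? {n} G k S =
  map′ (λ all v → n , all v) (λ pd v → PowerSet.⊆-at-n G k S (proj₁ (pd v)) (proj₂ (pd v)))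
       (all? (λ v → v ∈? powerSet G k S n))

full-isPowerDominating : ∀ {n} (G : Graph n) k → IsPowerDominating G k full
full-isPowerDominating G k v = 0 , ∈closedNbhdSet⁺ G k ∈⊤ (inj₁ refl)

powerDomNumber-exists : ∀ {n} (G : Graph n) k → ∃ (PowerDomNumber G k)
powerDomNumber-exists {n} G k
  with least (λ m → anySubset? λ S → (∣ S ∣ ℕ.≟ m) ×-dec isPowerDominating? G k S)
             (full , ∣⊤∣≡n n , full-isPowerDominating G k)
... | m , witness , minimal = m , witness , λ S pd → minimal (S , refl , pd)

module _ {n} {G : Graph n} where

  reach-snoc : ∀ {u w v} → Reach G u w → adj G w v ≡ true → Reach G u v
  reach-snoc here       wv = step wv here
  reach-snoc (step a r) wv = step a (reach-snoc r wv)

  reach-trans : ∀ {u w v} → Reach G u w → Reach G w v → Reach G u v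
  reach-trans here       r′ = r′
  reach-trans (step a r) r′ = step a (reach-trans r r′)

  reach-sym : Symmetric G → ∀ {u v} → Reach G u v → Reach G v u
  reach-sym sym-adj here = here
  reach-sym sym-adj {u} (step {w = w} uw r) = reach-snoc (reach-sym sym-adj r) (trans (sym-adj w u) uw)

  InClosedNbhd⇒reach : ∀ {s v} → InClosedNbhd G s v → Reach G s v
  InClosedNbhd⇒reach (inj₁ refl) = here
  InClosedNbhd⇒reach (inj₂ sv)   = step sv here

InClosedNbhd-mono : ∀ {n} {G H : Graph n} → (∀ a b → adj H a b ≡ true → adj G a b ≡ true) →
                    ∀ {u w} → InClosedNbhd H u w → InClosedNbhd G u w
InClosedNbhd-mono H⊆G (inj₁ w≡u) = inj₁ w≡u
InClosedNbhd-mono H⊆G (inj₂ uw)  = inj₂ (H⊆G _ _ uw)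

reach-mono : ∀ {n} {G H : Graph n} → (∀ a b → adj H a b ≡ true → adj G a b ≡ true) →
             ∀ {u v} → Reach H u v → Reach G u v
reach-mono H⊆G here       = here
reach-mono H⊆G (step a r) = step (H⊆G _ _ a) (reach-mono H⊆G r)

observer : ∀ {n} (G : Graph n) k S t {w} → w ∈ powerSet G k S t → ∃ λ s → s ∈ S × Reach G s w
observer G k S zero w∈ with ∈closedNbhdSet⁻ G k w∈
... | s , s∈S , w∈N = s , s∈S , InClosedNbhd⇒reach w∈N
observer G k S (suc t) w∈ with ∈propStep⁻ G k w∈
... | u , u∈P , _ , w∈N with observer G k S t u∈P
...   | s , s∈S , r = s , s∈S , reach-trans r (InClosedNbhd⇒reach w∈N)

-- With threshold n every observed vertex forces, so propagation from {x} sweeps out the component of x.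
reach? : ∀ {n} (G : Graph n) x v → Dec (Reach G x v)
reach? {n} G x v with v ∈? powerSet G n ⁅ x ⁆ n
... | yes v∈ with observer G n ⁅ x ⁆ n v∈
...   | s , s∈ , r with x∈⁅y⁆⇒x≡y x s∈
...     | refl = yes r
reach? {n} G x v | no v∉ = no λ r → v∉ (sweep r 0 (∈closedNbhdSet⁺ G n (x∈⁅x⁆ x) (inj₁ refl)))
  where
  sweep : ∀ {u w} → Reach G u w → ∀ t → u ∈ powerSet G n ⁅ x ⁆ t → w ∈ powerSet G n ⁅ x ⁆ n
  sweep here       t u∈ = PowerSet.⊆-at-n G n ⁅ x ⁆ t u∈
  sweep {u} (step a r) t u∈ =
    sweep r (suc t) (∈propStep⁺ G n u∈ (∣p∣≤n (closedNbhd G u ∩ ∁ (powerSet G n ⁅ x ⁆ t))) (inj₂ a))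

module _ {n} (G : Graph n) (x y : Fin n) where

  deleteEdge-⊆ : ∀ a b → adj (deleteEdge G x y) a b ≡ true → adj G a b ≡ true
  deleteEdge-⊆ a b p = proj₁ (∧-true⁻ p)

  deleteEdge-sym : Symmetric G → Symmetric (deleteEdge G x y)
  deleteEdge-sym sym-adj u v rewrite sym-adj u v
    | ∧-comm ⌊ u ≟ x ⌋ ⌊ v ≟ y ⌋ | ∧-comm ⌊ u ≟ y ⌋ ⌊ v ≟ x ⌋
    | ∨-comm (⌊ v ≟ y ⌋ ∧ ⌊ u ≟ x ⌋) (⌊ v ≟ x ⌋ ∧ ⌊ u ≟ y ⌋) = refl

  deleteEdge-removes : adj (deleteEdge G x y) x y ≡ false
  deleteEdge-removes rewrite ≟-refl x | ≟-refl y = ∧-zeroʳ (adj G x y)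

  deleteEdge-keeps : ∀ {a b} → adj G a b ≡ true → ¬ (a ≡ x × b ≡ y) → ¬ (a ≡ y × b ≡ x) →
                     adj (deleteEdge G x y) a b ≡ true
  deleteEdge-keeps {a} {b} ab ne₁ ne₂ rewrite ab | ≟∧≟-false ne₁ | ≟∧≟-false ne₂ = refl

data Last {A : Set} : List A → A → Set where
  last : ∀ {v} → Last (v ∷ []) v
  skip : ∀ {x l v} → Last l v → Last (x ∷ l) v

SimplePath : ∀ {n} → Graph n → Fin n → Fin n → Set
SimplePath {n} G u v = Σ (List (Fin n)) λ vs → Unique (u ∷ vs) × Linked G (u ∷ vs) × Last (u ∷ vs) v

simplePath-suffix : ∀ {n} {G : Graph n} {z v} l → z ∈L l → Unique l → Linked G l → Last l v →
                    SimplePath G z v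
simplePath-suffix (_ ∷ l) (here refl) u lk e = l , u , lk , e
simplePath-suffix (_ ∷ y ∷ l) (there z∈) (_ ∷ u) (_ , lk) (skip e) = simplePath-suffix (y ∷ l) z∈ u lk e

reach⇒simplePath : ∀ {n} {G : Graph n} {u v} → Reach G u v → SimplePath G u v
reach⇒simplePath here = [] , [] ∷ [] , tt , last
reach⇒simplePath {u = u} (step {w = w} uw r) with reach⇒simplePath r
... | ws , uniq , lk , e with any? (u ≟_) (w ∷ ws)
...   | yes u∈ = simplePath-suffix (w ∷ ws) u∈ uniq lk e
...   | no  u∉ = w ∷ ws , ¬Any⇒All¬ (w ∷ ws) u∉ ∷ uniq , (uw , lk) , skip e

linked-mono : ∀ {n} {G H : Graph n} → (∀ a b → adj H a b ≡ true → adj G a b ≡ true) →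
              ∀ l → Linked H l → Linked G l
linked-mono H⊆G []          _        = tt
linked-mono H⊆G (_ ∷ [])    _        = tt
linked-mono H⊆G (a ∷ b ∷ l) (ab , lk) = H⊆G a b ab , linked-mono H⊆G (b ∷ l) lk

linked-snoc : ∀ {n} {G : Graph n} {y z} l → Linked G l → Last l y → adj G y z ≡ true →
              Linked G (l ++ [ z ])
linked-snoc (_ ∷ [])     _        last     yz = yz , tt
linked-snoc (_ ∷ b ∷ l) (ab , lk) (skip e) yz = ab , linked-snoc (b ∷ l) lk e yz

EdgeCritical : ∀ {n} → ℕ → Graph n → Set
EdgeCritical k G = ∀ x y → adj G x y ≡ true → ∀ a b →
  PowerDomNumber G k a → PowerDomNumber (deleteEdge G x y) k b → a < b

forest-deleteEdge-disconnects : ∀ {n} (G : Graph n) → IsSimple G → IsForest G →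
  ∀ {x y} → adj G x y ≡ true → ¬ Reach (deleteEdge G x y) x y
forest-deleteEdge-disconnects G (sym-adj , loopless) forest {x} {y} xy r with reach⇒simplePath r
... | vs , uniq , lk , e = forest (x , vs , long vs lk e , uniq ,
        linked-snoc (x ∷ vs) (linked-mono (deleteEdge-⊆ G x y) (x ∷ vs) lk) e (trans (sym-adj y x) xy))
  where
  long : ∀ vs → Linked (deleteEdge G x y) (x ∷ vs) → Last (x ∷ vs) y → 2 ≤ length vs
  long []          _        last        with () ← trans (sym xy) (loopless x)
  long (_ ∷ [])    (xy′ , _) (skip last) with () ← trans (sym xy′) (deleteEdge-removes G x y)
  long (_ ∷ _ ∷ _) _        _           = s≤s (s≤s z≤n)

module _ {n} (G : Graph n) (sym-adj : Symmetric G) (k : ℕ) {S : Subset n} {c : Fin n} (c∈S : c ∈ S)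
         (small : ∀ {v} → Reach G c v → v ≢ c → ¬ (k + 2 ≤ degree G v)) where

  private
    P : ℕ → Subset n
    P = powerSet G k S

    c-observes : ∀ {z} → InClosedNbhd G c z → z ∈ P 0
    c-observes = ∈closedNbhdSet⁺ G k c∈S

  -- Walking away from c, each vertex other than c has degree ≤ k + 1 and an observed
  -- predecessor, so it can force its next neighbour.
  centre-observes-component : ∀ {v} → Reach G c v → ∃ λ t → v ∈ P t
  centre-observes-component r = walk here r 0 (c-observes (inj₁ refl)) (inj₁ refl)
    where
    walk : ∀ {w v} → Reach G c w → Reach G w v → ∀ t → w ∈ P t →
           w ≡ c ⊎ (∃ λ p → p ∈ P t × adj G p w ≡ true) → ∃ λ t → v ∈ P t
    walk _  here t w∈ _ = t , w∈
    walk {w} rc (step {w = w′} ww′ r) t w∈ pred with w ≟ c | pred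
    ... | yes refl | _ = walk (reach-snoc rc ww′) r 1 (powerSet-⊆-suc G k S 0 (c-observes (inj₂ ww′)))
                          (inj₂ (c , powerSet-⊆-suc G k S 0 (c-observes (inj₁ refl)) , ww′))
    ... | no w≢c | inj₁ w≡c = ⊥-elim (w≢c w≡c)
    ... | no w≢c | inj₂ (p , p∈ , pw) = walk (reach-snoc rc ww′) r (suc t)
          (∈propStep⁺ G k w∈ forces (inj₂ ww′)) (inj₂ (w , powerSet-⊆-suc G k S t w∈ , ww′))
      where
      low : degree G w ≤ suc k
      low = ℕ.≤-pred (subst (degree G w <_) (ℕ.+-comm k 2) (ℕ.≰⇒> (small rc w≢c)))
      forces : unobserved G w (P t) ≤ k
      forces = ℕ.≤-pred (ℕ.<-≤-trans (unobserved<degree G sym-adj w∈ p∈ pw) low)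

module _ {n} (G : Graph n) (sym-adj : Symmetric G) (k : ℕ) {x y : Fin n} (xy : adj G x y ≡ true)
         {S′ S : Subset n} (kept : ∀ {s} → s ∈ S′ → ¬ Reach G x s → s ∈ S) where

  private
    G-xy : Graph n
    G-xy = deleteEdge G x y

    ⊆G : ∀ {u w} → InClosedNbhd G-xy u w → InClosedNbhd G u w
    ⊆G = InClosedNbhd-mono (deleteEdge-⊆ G x y)

    ¬reach-backward : ∀ {u w} → ¬ Reach G x w → InClosedNbhd G u w → ¬ Reach G x u
    ¬reach-backward x↛w w∈N x→u = x↛w (reach-trans x→u (InClosedNbhd⇒reach w∈N))

    ¬reach-forward : ∀ {u z} → ¬ Reach G x u → InClosedNbhd G u z → ¬ Reach G x z
    ¬reach-forward x↛u (inj₁ refl) = x↛u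
    ¬reach-forward x↛u (inj₂ uz) x→z = x↛u (reach-snoc x→z (trans (sym-adj _ _) uz))

    ⊆G-xy : ∀ {u z} → ¬ Reach G x u → InClosedNbhd G u z → InClosedNbhd G-xy u z
    ⊆G-xy x↛u (inj₁ z≡u) = inj₁ z≡u
    ⊆G-xy x↛u (inj₂ uz) = inj₂ (deleteEdge-keeps G x y uz
      (λ (u≡x , _) → x↛u (subst (Reach G x) (sym u≡x) here))
      (λ (u≡y , _) → x↛u (subst (Reach G x) (sym u≡y) (step xy here))))

  observed-away-from-edge : ∀ t {w} → ¬ Reach G x w → w ∈ powerSet (deleteEdge G x y) k S′ t →
                            w ∈ powerSet G k S t
  observed-away-from-edge zero x↛w w∈ with ∈closedNbhdSet⁻ G-xy k w∈
  ... | s , s∈S′ , w∈N = ∈closedNbhdSet⁺ G k (kept s∈S′ (¬reach-backward x↛w (⊆G w∈N))) (⊆G w∈N)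
  observed-away-from-edge (suc t) x↛w w∈ with ∈propStep⁻ G-xy k w∈
  ... | u , u∈ , forces , w∈N = ∈propStep⁺ G k (observed-away-from-edge t x↛u u∈)
          (≤-trans (unobserved-mono G-xy G λ z∈N z∉ → ⊆G-xy x↛u z∈N
             , λ z∈ → z∉ (observed-away-from-edge t (¬reach-forward x↛u z∈N) z∈)) forces)
          (⊆G w∈N)
    where
    x↛u : ¬ Reach G x u
    x↛u = ¬reach-backward x↛w (⊆G w∈N)

module _ {n} (k : ℕ) (G : Graph n) (simple : IsSimple G) (spiders : IsUnionOfSpiders k G) where

  private
    sym-adj : Symmetric G
    sym-adj = proj₁ simple

  component-centre : ∀ x → ∃ λ c → Reach G x c × (∀ {v} → Reach G c v → v ≢ c → ¬ (k + 2 ≤ degree G v))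
  component-centre x with anyFin? (λ h → reach? G x h ×-dec (k + 2 ≤? degree G h))
  ... | yes (h , x→h , big) = h , x→h , λ h→v v≢h big′ → v≢h (sym (proj₂ spiders h _ h→v big big′))
  ... | no  none            = x , here , λ x→v _ big → none (_ , x→v , big)

  spiders-shrink : ∀ {x y} → adj G x y ≡ true → ∀ {S′} → IsPowerDominating (deleteEdge G x y) k S′ →
                   ∃ λ S → ∣ S ∣ < ∣ S′ ∣ × IsPowerDominating G k S
  spiders-shrink {x} {y} xy {S′} pd′ with observed-by x | observed-by y | component-centre x
    where
    observed-by : ∀ v → ∃ λ s → s ∈ S′ × Reach (deleteEdge G x y) s v
    observed-by v = observer _ k S′ (proj₁ (pd′ v)) (proj₂ (pd′ v))
  ... | sx , sx∈ , sx→x | sy , sy∈ , sy→y | c , x→c , small = S , smaller , pd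
    where
    x→sx : Reach G x sx
    x→sx = reach-sym sym-adj (reach-mono (deleteEdge-⊆ G x y) sx→x)
    x→sy : Reach G x sy
    x→sy = step xy (reach-sym sym-adj (reach-mono (deleteEdge-⊆ G x y) sy→y))
    sx≢sy : sx ≢ sy
    sx≢sy refl = forest-deleteEdge-disconnects G simple (proj₁ spiders) xy
                   (reach-trans (reach-sym (deleteEdge-sym G x y sym-adj) sx→x) sy→y)

    S : Subset n
    S = (S′ - sx - sy) ∪ ⁅ c ⁆

    smaller : ∣ S ∣ < ∣ S′ ∣
    smaller = ℕ.≤-<-trans (∣p∪⁅x⁆∣≤1+∣p∣ (S′ - sx - sy) c)
      (ℕ.<-≤-trans (s≤s (x∈p⇒∣p-x∣<∣p∣ (x∈p∧x≢y⇒x∈p-y sy∈ (sx≢sy ∘ sym)))) (x∈p⇒∣p-x∣<∣p∣ sx∈))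

    kept : ∀ {s} → s ∈ S′ → ¬ Reach G x s → s ∈ S
    kept s∈ x↛s = x∈p∪q⁺ (inj₁ (x∈p∧x≢y⇒x∈p-y (x∈p∧x≢y⇒x∈p-y s∈
      (λ { refl → x↛s x→sx })) (λ { refl → x↛s x→sy })))

    pd : IsPowerDominating G k S
    pd v with reach? G x v
    ... | yes x→v = centre-observes-component G sym-adj k (x∈p∪q⁺ (inj₂ (x∈⁅x⁆ c))) small
                      (reach-trans (reach-sym sym-adj x→c) x→v)
    ... | no  x↛v =
      proj₁ (pd′ v) , observed-away-from-edge G sym-adj k xy kept (proj₁ (pd′ v)) x↛v (proj₂ (pd′ v))

  spiders⇒edgeCritical : EdgeCritical k G
  spiders⇒edgeCritical x y xy a b (_ , minimal) ((S′ , ∣S′∣≡b , pd′) , _) with spiders-shrink xy pd′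
  ... | S , smaller , pd = ℕ.≤-<-trans (minimal S pd) (subst (∣ S ∣ <_) ∣S′∣≡b smaller)

module Parent {n} (G : Graph n) (k : ℕ) {S : Subset n} (pd : IsPowerDominating G k S) where

  P : ℕ → Subset n
  P = powerSet G k S

  -- S itself is stage 0, so the vertices of S rank strictly below the ones they observe.
  stage : ℕ → Subset n
  stage zero    = S
  stage (suc t) = P t

  private
    firstStage : ∀ w → ∃ λ r → w ∈ stage r × ∀ {i} → w ∈ stage i → r ≤ i
    firstStage w = least (λ i → w ∈? stage i) {suc (proj₁ (pd w))} (proj₂ (pd w))

  rank : Fin n → ℕ
  rank w = proj₁ (firstStage w)

  rank-stage : ∀ w → w ∈ stage (rank w)
  rank-stage w = proj₁ (proj₂ (firstStage w))

  rank-minimal : ∀ {w i} → w ∈ stage i → rank w ≤ i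
  rank-minimal {w} = proj₂ (proj₂ (firstStage w))

  rank-pos : ∀ {w} → w ∉ S → 0 < rank w
  rank-pos {w} w∉S with rank w | rank-stage w
  ... | zero  | w∈S = ⊥-elim (w∉S w∈S)
  ... | suc _ | _   = s≤s z≤n

  data ObservedVia (w u : Fin n) : Set where
    dominated : u ∈ S → adj G u w ≡ true → ObservedVia w u
    forced    : ∀ t → rank w ≡ suc (suc t) → u ∈ P t → unobserved G u (P t) ≤ k → adj G u w ≡ true →
                ObservedVia w u

  observedVia : ∀ w → w ∉ S → ∃ (ObservedVia w)
  observedVia w w∉S = go (rank w) refl
    where
    go : ∀ r → rank w ≡ r → ∃ (ObservedVia w)
    go zero eq = ⊥-elim (w∉S (subst (λ i → w ∈ stage i) eq (rank-stage w)))
    go (suc zero) eq with ∈closedNbhdSet⁻ G k (subst (λ i → w ∈ stage i) eq (rank-stage w))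
    ... | s , s∈S , inj₁ refl = ⊥-elim (w∉S s∈S)
    ... | s , s∈S , inj₂ sw   = s , dominated s∈S sw
    go (suc (suc t)) eq with ∈propStep⁻ G k (subst (λ i → w ∈ stage i) eq (rank-stage w))
    ... | u , u∈ , few , inj₁ refl =
      ⊥-elim (ℕ.n≮n (suc t) (subst (_≤ suc t) eq (rank-minimal {i = suc t} u∈)))
    ... | u , u∈ , few , inj₂ uw   = u , forced t eq u∈ few uw

  -- On S the value is irrelevant: parents are only ever used through HasParent.
  parent : Fin n → Fin n
  parent w with w ∈? S
  ... | yes _   = w
  ... | no  w∉S = proj₁ (observedVia w w∉S)

  parent-observes : ∀ {w} → w ∉ S → ObservedVia w (parent w)
  parent-observes {w} w∉S with w ∈? S
  ... | yes w∈S  = ⊥-elim (w∉S w∈S)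
  ... | no  w∉S′ = proj₂ (observedVia w w∉S′)

  HasParent : Fin n → Fin n → Set
  HasParent w u = w ∉ S × parent w ≡ u

  hasParent? : ∀ w u → Dec (HasParent w u)
  hasParent? w u = ¬? (w ∈? S) ×-dec (parent w ≟ u)

  rank-parent : ∀ {w u} → HasParent w u → rank u < rank w
  rank-parent {w} (w∉S , refl) with parent-observes w∉S
  ... | dominated u∈S _    = ℕ.≤-<-trans (rank-minimal {i = 0} u∈S) (rank-pos w∉S)
  ... | forced t eq u∈ _ _ = subst (rank (parent w) <_) (sym eq) (s≤s (rank-minimal {i = suc t} u∈))

  module _ {x y : Fin n} (x↚y : ¬ HasParent x y) (y↚x : ¬ HasParent y x) where

    private
      G-xy : Graph n
      G-xy = deleteEdge G x y

      P′ : ℕ → Subset n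
      P′ = powerSet G-xy k S

      parent-edge-kept : ∀ {w} → w ∉ S → adj G (parent w) w ≡ true → adj G-xy (parent w) w ≡ true
      parent-edge-kept {w} w∉S pw = deleteEdge-keeps G x y pw
        (λ (p≡x , w≡y) → y↚x (subst (_∉ S) w≡y w∉S , trans (cong parent (sym w≡y)) p≡x))
        (λ (p≡y , w≡x) → x↚y (subst (_∉ S) w≡x w∉S , trans (cong parent (sym w≡x)) p≡y))

    observed-without-edge : ∀ t {w} → w ∈ P t → w ∈ P′ t
    observed-without-edge t {w} w∈ with w ∈? S
    ... | yes w∈S = PowerSet.⊆-mono G-xy k S {0} {t} z≤n (∈closedNbhdSet⁺ G-xy k w∈S (inj₁ refl))
    ... | no  w∉S with parent-observes w∉S | t
    ...   | dominated s∈S sw | t =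
            PowerSet.⊆-mono G-xy k S {0} {t} z≤n
              (∈closedNbhdSet⁺ G-xy k s∈S (inj₂ (parent-edge-kept w∉S sw)))
    ...   | forced t′ eq _ _ _ | zero =
            ⊥-elim (ℕ.≤⇒≯ (rank-minimal {i = 1} w∈) (subst (1 <_) (sym eq) (s≤s (s≤s z≤n))))
    ...   | forced t′ eq u∈ few uw | suc t = ∈propStep⁺ G-xy k (observed-without-edge t u∈P) few′
            (inj₂ (parent-edge-kept w∉S uw))
      where
      t′≤t : t′ ≤ t
      t′≤t = ℕ.≤-pred (ℕ.≤-pred (subst (_≤ suc (suc t)) eq (rank-minimal {i = suc (suc t)} w∈)))
      u∈P : parent w ∈ P t
      u∈P = PowerSet.⊆-mono G k S t′≤t u∈
      few′ : unobserved G-xy (parent w) (P′ t) ≤ k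
      few′ = ≤-trans (unobserved-mono G G-xy λ z∈N z∉ → InClosedNbhd-mono (deleteEdge-⊆ G x y) z∈N
               , λ z∈ → z∉ (observed-without-edge t (PowerSet.⊆-mono G k S t′≤t z∈))) few

    deleteEdge-isPowerDominating : IsPowerDominating G-xy k S
    deleteEdge-isPowerDominating v = proj₁ (pd v) , observed-without-edge (proj₁ (pd v)) (proj₂ (pd v))

NoBacktrack : ∀ {A : Set} → List A → Set
NoBacktrack (a ∷ b ∷ c ∷ l) = a ≢ c × NoBacktrack (b ∷ c ∷ l)
NoBacktrack _               = ⊤

unique⇒noBacktrack : ∀ {A : Set} (l : List A) → Unique l → NoBacktrack l
unique⇒noBacktrack []              _                       = tt
unique⇒noBacktrack (_ ∷ [])        _                       = tt
unique⇒noBacktrack (_ ∷ _ ∷ [])    _                       = tt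
unique⇒noBacktrack (a ∷ b ∷ c ∷ l) ((_ ∷ a≢c ∷ _) ∷ uniq) = a≢c , unique⇒noBacktrack (b ∷ c ∷ l) uniq

data LastTwo {A : Set} : List A → A → A → Set where
  lastTwo : ∀ {a b} → LastTwo (a ∷ b ∷ []) a b
  skip₂   : ∀ {x l a b} → LastTwo l a b → LastTwo (x ∷ l) a b

last-exists : ∀ {A : Set} (x : A) xs → ∃ (Last (x ∷ xs))
last-exists x []       = x , last
last-exists x (y ∷ ys) with last-exists y ys
... | z , e = z , skip e

last⇒lastTwo : ∀ {A : Set} {z : A} a b l → Last (a ∷ b ∷ l) z → ∃ λ z′ → LastTwo (a ∷ b ∷ l) z′ z
last⇒lastTwo a b []      (skip last) = a , lastTwo
last⇒lastTwo a b (c ∷ l) (skip e)    with last⇒lastTwo b c l e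
... | z′ , e₂ = z′ , skip₂ e₂

last-snoc : ∀ {A : Set} {z : A} v xs → Last xs z → LastTwo (xs ++ [ v ]) z v
last-snoc v (_ ∷ [])    last     = lastTwo
last-snoc v (_ ∷ b ∷ l) (skip e) = skip₂ (last-snoc v (b ∷ l) e)

last-∈ : ∀ {A : Set} {z : A} xs → Last xs z → z ∈L xs
last-∈ (_ ∷ [])    last     = here refl
last-∈ (_ ∷ b ∷ l) (skip e) = there (last-∈ (b ∷ l) e)

lastTwo-adj : ∀ {n} {G : Graph n} {a b} l → Linked G l → LastTwo l a b → adj G a b ≡ true
lastTwo-adj (_ ∷ _ ∷ [])    (ab , _) lastTwo  = ab
lastTwo-adj (_ ∷ _ ∷ [])    _        (skip₂ (skip₂ ()))
lastTwo-adj (_ ∷ b ∷ c ∷ l) (_ , lk) (skip₂ e) = lastTwo-adj (b ∷ c ∷ l) lk e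

cycle-closing : ∀ {A : Set} (v a b : A) l → Unique (v ∷ a ∷ b ∷ l) →
  ∃ λ z → LastTwo (v ∷ a ∷ b ∷ l ++ [ v ]) z v × a ≢ z × NoBacktrack (v ∷ a ∷ b ∷ l ++ [ v ])
cycle-closing v a b l uniq@((_ ∷ v≢b ∷ _) ∷ uniq′@(a∉ ∷ _)) with last-exists b l
... | z , e = z , last-snoc v (v ∷ a ∷ b ∷ l) (skip (skip e)) , All.lookup a∉ (last-∈ (b ∷ l) e)
            , v≢b , unique⇒noBacktrack (a ∷ b ∷ l ++ [ v ])
                      (Unique.++⁺ uniq′ ([] ∷ [])
                        λ { (v∈ , here refl) → Unique.Unique[x∷xs]⇒x∉xs uniq v∈ })

module _ {n} (k : ℕ) (G : Graph n) (critical : EdgeCritical k G)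
         {γ : ℕ} {S : Subset n} (∣S∣≡γ : ∣ S ∣ ≡ γ) (pd : IsPowerDominating G k S)
         (γ-minimal : ∀ S′ → IsPowerDominating G k S′ → γ ≤ ∣ S′ ∣) where

  open Parent G k pd

  -- Otherwise xy could be deleted without losing S, contradicting criticality.
  parent-edge : ∀ {x y} → adj G x y ≡ true → HasParent x y ⊎ HasParent y x
  parent-edge {x} {y} xy with hasParent? x y | hasParent? y x
  ... | yes x↤y | _       = inj₁ x↤y
  ... | no  _   | yes y↤x = inj₂ y↤x
  ... | no  x↚y | no  y↚x = ⊥-elim (ℕ.<⇒≱ (critical x y xy γ b ((S , ∣S∣≡γ , pd) , γ-minimal) b-number)
          (subst (b ≤_) ∣S∣≡γ (proj₂ b-number S (deleteEdge-isPowerDominating x↚y y↚x))))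
    where
    b : ℕ
    b = proj₁ (powerDomNumber-exists (deleteEdge G x y) k)
    b-number : PowerDomNumber (deleteEdge G x y) k b
    b-number = proj₂ (powerDomNumber-exists (deleteEdge G x y) k)

  descending-path : ∀ u₀ u₁ l {z′ z} → Linked G (u₀ ∷ u₁ ∷ l) → NoBacktrack (u₀ ∷ u₁ ∷ l) →
    LastTwo (u₀ ∷ u₁ ∷ l) z′ z → HasParent u₁ u₀ → rank u₀ < rank z × HasParent z z′
  descending-path u₀ u₁ []       _        _          lastTwo           u₁↤u₀ = rank-parent u₁↤u₀ , u₁↤u₀
  descending-path u₀ u₁ []       _        _          (skip₂ (skip₂ ()))
  descending-path u₀ u₁ (u₂ ∷ l) (_ , lk) (u₀≢u₂ , nb) (skip₂ e)       u₁↤u₀ with parent-edge (proj₁ lk)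
  ... | inj₁ u₁↤u₂ = ⊥-elim (u₀≢u₂ (trans (sym (proj₂ u₁↤u₀)) (proj₂ u₁↤u₂)))
  ... | inj₂ u₂↤u₁ with descending-path u₁ u₂ l lk nb e u₂↤u₁
  ...   | rank< , z↤z′ = ℕ.<-trans (rank-parent u₁↤u₀) rank< , z↤z′

  ascending-path : ∀ u₀ u₁ l {z′ z} → Linked G (u₀ ∷ u₁ ∷ l) → NoBacktrack (u₀ ∷ u₁ ∷ l) →
    LastTwo (u₀ ∷ u₁ ∷ l) z′ z → HasParent z′ z → rank z < rank u₀ × HasParent u₀ u₁
  ascending-path u₀ u₁ []       _         _          lastTwo           z′↤z = rank-parent z′↤z , z′↤z
  ascending-path u₀ u₁ []       _         _          (skip₂ (skip₂ ()))
  ascending-path u₀ u₁ (u₂ ∷ l) (u₀u₁ , lk) (u₀≢u₂ , nb) (skip₂ e)     z′↤z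
    with ascending-path u₁ u₂ l lk nb e z′↤z
  ... | rank< , u₁↤u₂ with parent-edge u₀u₁
  ...   | inj₁ u₀↤u₁ = ℕ.<-trans rank< (rank-parent u₀↤u₁) , u₀↤u₁
  ...   | inj₂ u₁↤u₀ = ⊥-elim (u₀≢u₂ (trans (sym (proj₂ u₁↤u₀)) (proj₂ u₁↤u₂)))

  critical⇒forest : IsForest G
  critical⇒forest (v , []        , ()        , _)
  critical⇒forest (v , _ ∷ []    , s≤s ()    , _)
  critical⇒forest (v , a ∷ b ∷ l , _ , uniq , lk) with cycle-closing v a b l uniq
  ... | z , e , a≢z , nb with parent-edge (proj₁ lk)
  ...   | inj₂ a↤v = ℕ.<-irrefl refl (proj₁ (descending-path v a (b ∷ l ++ [ v ]) lk nb e a↤v))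
  ...   | inj₁ v↤a with parent-edge (lastTwo-adj (v ∷ a ∷ b ∷ l ++ [ v ]) lk e)
  ...     | inj₁ z↤v = ℕ.<-irrefl refl (proj₁ (ascending-path v a (b ∷ l ++ [ v ]) lk nb e z↤v))
  ...     | inj₂ v↤z = a≢z (trans (sym (proj₂ v↤a)) (proj₂ v↤z))

  private
    nonParentNbrs : Fin n → Subset n
    nonParentNbrs h = openNbhd G h ∩ ∁ ⁅ parent h ⁆

    child : ∀ {h z} → z ∈ nonParentNbrs h → HasParent z h
    child {h} {z} z∈ with x∈p∩q⁻ _ _ z∈
    ... | hz , z∉ with parent-edge (∈-tabulate⁻ hz)
    ...   | inj₁ h↤z = ⊥-elim (x∉⁅y⁆⇒x≢y (x∈∁p⇒x∉p z∉) (sym (proj₂ h↤z)))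
    ...   | inj₂ z↤h = z↤h

  -- The earliest observed child w of h is forced by h while all children are still unobserved.
  few-children : ∀ {h} → h ∉ S → ∣ nonParentNbrs h ∣ ≤ k
  few-children {h} h∉S with nonempty? (nonParentNbrs h)
  ... | no  none = ≤-trans (≤-reflexive (∣Empty∣≡0 none)) z≤n
  ... | yes (w₀ , w₀∈)
    with least (λ r → anyFin? λ z → (z ∈? nonParentNbrs h) ×-dec (rank z ℕ.≟ r)) (w₀ , w₀∈ , refl)
  ...   | _ , (w , w∈ , refl) , earliest
    with child w∈
  ...     | w∉S , refl with parent-observes w∉S
  ...       | dominated h∈S _ = ⊥-elim (h∉S h∈S)
  ...       | forced t eq h∈P few _ = ≤-trans (p⊆q⇒∣p∣≤∣q∣ unobserved-children) few
    where
    unobserved-children : nonParentNbrs h ⊆ closedNbhd G h ∩ ∁ (P t)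
    unobserved-children {z} z∈ = ∈unobserved⁺ G (inj₂ (∈-tabulate⁻ (proj₁ (x∈p∩q⁻ _ _ z∈)))) λ z∈P →
      ℕ.≤⇒≯ (earliest (z , z∈ , refl)) (subst (rank z <_) (sym eq) (s≤s (rank-minimal {i = suc t} z∈P)))

  high-degree⇒∈S : ∀ {h} → k + 2 ≤ degree G h → h ∈ S
  high-degree⇒∈S {h} high with h ∈? S
  ... | yes h∈S = h∈S
  ... | no  h∉S = ⊥-elim (ℕ.<-irrefl refl (≤-trans high′
                    (≤-trans (∣p∣≤1+∣p∩∁⁅x⁆∣ (openNbhd G h) (parent h)) (s≤s (few-children h∉S)))))
    where
    high′ : suc (suc k) ≤ degree G h
    high′ = subst (_≤ degree G h) (ℕ.+-comm k 2) high

  -- Leaving a vertex of S, the path must descend, so it cannot end at another vertex of S.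
  high-degree-unique : ∀ u v → Reach G u v → k + 2 ≤ degree G u → k + 2 ≤ degree G v → u ≡ v
  high-degree-unique u v r high-u high-v with reach⇒simplePath r
  ... | []     , _    , _  , last = refl
  ... | u₁ ∷ l , uniq , lk , e with parent-edge (proj₁ lk) | last⇒lastTwo u u₁ l e
  ...   | inj₁ u↤u₁ | _       = ⊥-elim (proj₁ u↤u₁ (high-degree⇒∈S high-u))
  ...   | inj₂ u₁↤u | v′ , e₂ = ⊥-elim (proj₁ (proj₂ descends) (high-degree⇒∈S high-v))
    where
    descends : rank u < rank v × HasParent v v′
    descends = descending-path u u₁ l lk (unique⇒noBacktrack _ uniq) e₂ u₁↤u

edgeCritical⇒unionOfSpiders : ∀ {n} k (G : Graph n) → EdgeCritical k G → IsUnionOfSpiders k G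
edgeCritical⇒unionOfSpiders k G critical = from-γ-set (proj₂ (powerDomNumber-exists G k))
  where
  from-γ-set : ∀ {γ} → PowerDomNumber G k γ → IsUnionOfSpiders k G
  from-γ-set ((S , ∣S∣≡γ , pd) , minimal) =
    critical⇒forest k G critical ∣S∣≡γ pd minimal , high-degree-unique k G critical ∣S∣≡γ pd minimal

-- Neither direction uses 1 ≤ k.
theorem4 : ∀ {n} (k : ℕ) (G : Graph n) → IsSimple G → 1 ≤ k →
    ((∀ x y → adj G x y ≡ true → ∀ a b →
        PowerDomNumber G k a → PowerDomNumber (deleteEdge G x y) k b → a < b)
      → IsUnionOfSpiders k G)
    × (IsUnionOfSpiders k G →
      (∀ x y → adj G x y ≡ true → ∀ a b →
        PowerDomNumber G k a → PowerDomNumber (deleteEdge G x y) k b → a < b))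
theorem4 k G simple _ = edgeCritical⇒unionOfSpiders k G , spiders⇒edgeCritical k G simple
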